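{- For all integers $m\geq 1$, $a(2m)=\sum_{r=0}^m z(r)$.
   Context: A partition of a positive integer $n$ is a tuple $\lambda=(n_1,n_2,\dots,n_r)$ of positive integers with $n_1\geq n_2\geq\dots\geq n_r$ and $n_1+\dots+n_r=n$. The cyclicity index of $\lambda$ is $c(\lambda)=\sum_{i=1}^r(3-2i)n_i$, and $\lambda$ is attainable if $c(\lambda)\geq 0$. For $n\geq 1$, $a(n)$ is the number of attainable partitions of $n$; for $m\geq 1$, $z(m)$ is the number of partitions of $2m$ with cyclicity index $0$; by convention $z(0)=1$. -}

module Defs where

open import Data.Nat using (ℕ; zero; suc; _+_; _*_; _∸_; _≤?_)
open import Data.Integer as ℤ using (ℤ; +_; _≟_)
open import Data.Bool using (if_then_else_; _∧_)
open import Data.List using (List; []; _∷_; map; concatMap; length; filter; sum; upTo; applyUpTo)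
open import Relation.Nullary.Decidable using (⌊_⌋)

-- A partition is represented as a list of positive parts in nonincreasing order.
-- partsBounded k n : all partitions of n whose parts are all ≤ k,
-- listed (each exactly once) as nonincreasing lists of positive integers.
-- Defined by recursion on fuel f ≥ n.
partsB : ℕ → ℕ → ℕ → List (List ℕ)
partsB _       _ zero    = [] ∷ []
partsB zero    _ (suc _) = []
partsB (suc f) k (suc n) =
  concatMap (λ j → if ⌊ suc j ≤? k ⌋
                     then map (suc j ∷_) (partsB f (suc j) (suc n ∸ suc j))
                     else [])
            (upTo (suc n))

partitions : ℕ → List (List ℕ)
partitions n = partsB n n n

cycIdxFrom : ℕ → List ℕ → ℤ
cycIdxFrom i []       = + 0
cycIdxFrom i (x ∷ xs) = (+ 3 ℤ.- + (2 * i)) ℤ.* + x ℤ.+ cycIdxFrom (suc i) xs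

cyclicity : List ℕ → ℤ
cyclicity = cycIdxFrom 1

a : ℕ → ℕ
a n = length (filter (λ l → + 0 ℤ.≤? cyclicity l) (partitions n))

-- z(m): number of partitions of 2m with cyclicity index 0 (z 0 = 1 automatically,
-- matching the convention: the empty partition has index 0).
z : ℕ → ℕ
z m = length (filter (λ l → cyclicity l ≟ + 0) (partitions (2 * m)))

sumTo : ℕ → (ℕ → ℕ) → ℕ
sumTo zero    f = f 0
sumTo (suc m) f = sumTo m f + f (suc m)

-- Write an attainable partition of N + 1 as p ∷ r with first part p; its
-- cyclicity index is p − d(r), where the deficit d(r) has the parity of the
-- size of r. For odd N the size of r is N + 1 − p, so d(r) ≢ p − 1 and the
-- condition d(r) ≤ p splits into d(r) = p (the partitions of index 0) and
-- d(r) ≤ p − 2. In the second case every part of r is at most p − 2, so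
-- replacing p by p − 2 is a bijection onto the attainable partitions of
-- N − 1. Hence a(2m + 2) = a(2m) + z(m + 1), and the theorem follows by
-- induction from a(2) = 2 = z(0) + z(1).
module Submission where

open import Algebra.Properties.CommutativeSemigroup using (interchange)
open import Data.Bool using (if_then_else_)
open import Data.Empty using (⊥-elim)
open import Data.Integer as ℤ using (+_)
import Data.Integer.Properties as ℤ
open import Data.List using (List; []; _∷_; map; concatMap; length; filter; applyUpTo; _++_)
open import Data.Nat.ListAction using (sum)
open import Data.List.Properties using (length-++; filter-++; filter-none; filter-≐; concatMap-cong)
open import Data.List.Relation.Unary.All as All using (All; []; _∷_)
open import Data.List.Relation.Unary.All.Properties using (concat⁺; map⁺; applyUpTo⁺₁)
open import Data.Nat
open import Data.Nat.Properties
open import Data.Nat.Solver using (module +-*-Solver)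
open import Data.Product using (_,_)
open import Data.Sum using (_⊎_; inj₁; inj₂; [_,_])
open import Function using (_∘_; id)
open import Level using (Level)
open import Relation.Binary.PropositionalEquality using (_≡_; _≢_; refl; sym; trans; cong; cong₂; subst; module ≡-Reasoning)
open import Relation.Nullary using (¬_; yes; no)
open import Relation.Nullary.Decidable using (⌊_⌋)
open import Relation.Unary using (Pred; Decidable; _⊆_; _≐_)

open import Defs

private variable
  ℓ ℓ′ ℓ″ : Level
  A B : Set

count : {P : Pred A ℓ} → Decidable P → List A → ℕ
count P? xs = length (filter P? xs)

module _ {P : Pred A ℓ} (P? : Decidable P) where

  count-++ : (xs ys : List A) → count P? (xs ++ ys) ≡ count P? xs + count P? ys
  count-++ xs ys = trans (cong length (filter-++ P? xs ys)) (length-++ (filter P? xs))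

  count-map : (f : B → A) (xs : List B) → count P? (map f xs) ≡ count (P? ∘ f) xs
  count-map f []       = refl
  count-map f (x ∷ xs) with P? (f x)
  ... | yes _ = cong suc (count-map f xs)
  ... | no  _ = count-map f xs

  count-none : (xs : List A) → All (¬_ ∘ P) xs → count P? xs ≡ 0
  count-none xs = cong length ∘ filter-none P?

count-≐ : {P : Pred A ℓ} {Q : Pred A ℓ′} (P? : Decidable P) (Q? : Decidable Q) →
          P ≐ Q → (xs : List A) → count P? xs ≡ count Q? xs
count-≐ P? Q? P≐Q = cong length ∘ filter-≐ P? Q? P≐Q

count-⊎ : {P : Pred A ℓ} {Q : Pred A ℓ′} {R : Pred A ℓ″}
          (P? : Decidable P) (Q? : Decidable Q) (R? : Decidable R) →
          Q ⊆ P → R ⊆ P → (∀ x → Q x → ¬ R x) →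
          (xs : List A) → All (λ x → P x → Q x ⊎ R x) xs →
          count P? xs ≡ count Q? xs + count R? xs
count-⊎ P? Q? R? Q⊆P R⊆P Q∩R=∅ []       []               = refl
count-⊎ P? Q? R? Q⊆P R⊆P Q∩R=∅ (x ∷ xs) (P⇒Q⊎R ∷ P⇒Q⊎Rs)
  with ih ← count-⊎ P? Q? R? Q⊆P R⊆P Q∩R=∅ xs P⇒Q⊎Rs | P? x | Q? x | R? x
... | yes _ | yes q  | yes r  = ⊥-elim (Q∩R=∅ x q r)
... | yes _ | yes _  | no  _  = cong suc ih
... | yes _ | no  _  | yes _  = trans (cong suc ih) (sym (+-suc _ _))
... | yes p | no  ¬q | no  ¬r = ⊥-elim ([ ¬q , ¬r ] (P⇒Q⊎R p))
... | no ¬p | yes q  | _      = ⊥-elim (¬p (Q⊆P q))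
... | no ¬p | no  _  | yes r  = ⊥-elim (¬p (R⊆P r))
... | no  _ | no  _  | no  _  = ih

∑< : ℕ → (ℕ → ℕ) → ℕ
∑< zero    f = 0
∑< (suc n) f = f 0 + ∑< n (f ∘ suc)

∑<-cong : ∀ n {f g : ℕ → ℕ} → (∀ {j} → j < n → f j ≡ g j) → ∑< n f ≡ ∑< n g
∑<-cong zero    f≡g = refl
∑<-cong (suc n) f≡g = cong₂ _+_ (f≡g z<s) (∑<-cong n (f≡g ∘ s<s))

∑<-+ : ∀ n (f g : ℕ → ℕ) → ∑< n (λ j → f j + g j) ≡ ∑< n f + ∑< n g
∑<-+ zero    f g = refl
∑<-+ (suc n) f g = trans (cong (λ t → f 0 + g 0 + t) (∑<-+ n (f ∘ suc) (g ∘ suc)))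
                         (interchange +-commutativeSemigroup (f 0) (g 0) _ _)

count-concatMap-applyUpTo : {P : Pred A ℓ} (P? : Decidable P) (F : ℕ → List A) (g : ℕ → ℕ) →
  ∀ n → count P? (concatMap F (applyUpTo g n)) ≡ ∑< n (λ j → count P? (F (g j)))
count-concatMap-applyUpTo P? F g zero    = refl
count-concatMap-applyUpTo P? F g (suc n) =
  trans (count-++ P? (F (g 0)) _) (cong (_+_ (count P? (F (g 0)))) (count-concatMap-applyUpTo P? F (g ∘ suc) n))

partsB-fuel : ∀ {f f′} k s → s ≤ f → s ≤ f′ → partsB f k s ≡ partsB f′ k s
partsB-fuel k zero    _         _          = refl
partsB-fuel {suc f} {suc f′} k (suc s) (s≤s s≤f) (s≤s s≤f′) = concatMap-cong byFirstPart (applyUpTo id (suc s))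
  where
  byFirstPart : ∀ j → (if ⌊ suc j ≤? k ⌋ then map (suc j ∷_) (partsB f (suc j) (s ∸ j)) else [])
                    ≡ (if ⌊ suc j ≤? k ⌋ then map (suc j ∷_) (partsB f′ (suc j) (s ∸ j)) else [])
  byFirstPart j = cong (λ rs → if ⌊ suc j ≤? k ⌋ then map (suc j ∷_) rs else [])
    (partsB-fuel (suc j) (s ∸ j) (≤-trans (m∸n≤m s j) s≤f) (≤-trans (m∸n≤m s j) s≤f′))

partsB-sum : ∀ f k s → All (λ r → sum r ≡ s) (partsB f k s)
partsB-sum f       k zero    = refl ∷ []
partsB-sum zero    k (suc s) = []
partsB-sum (suc f) k (suc s) = concat⁺ (map⁺ (applyUpTo⁺₁ id (suc s) byFirstPart))
  where
  byFirstPart : ∀ {j} → j < suc s →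
    All (λ r → sum r ≡ suc s) (if ⌊ suc j ≤? k ⌋ then map (suc j ∷_) (partsB f (suc j) (s ∸ j)) else [])
  byFirstPart {j} (s≤s j≤s) with suc j ≤? k
  ... | no  _ = []
  ... | yes _ = map⁺ (All.map (λ sum≡s∸j → cong suc (trans (cong (_+_ j) sum≡s∸j) (m+[n∸m]≡n j≤s)))
                              (partsB-sum f (suc j) (s ∸ j)))

boundedPartitions : ℕ → ℕ → List (List ℕ)
boundedPartitions k s = partsB s k s

count-partitions-suc : {P : Pred (List ℕ) ℓ} (P? : Decidable P) (n : ℕ) →
  count P? (partitions (suc n)) ≡ ∑< (suc n) (λ j → count (P? ∘ (suc j ∷_)) (boundedPartitions (suc j) (n ∸ j)))
count-partitions-suc P? n = trans (count-concatMap-applyUpTo P? block id (suc n)) (∑<-cong (suc n) byFirstPart)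
  where
  block : ℕ → List (List ℕ)
  block j = if ⌊ suc j ≤? suc n ⌋ then map (suc j ∷_) (partsB n (suc j) (n ∸ j)) else []
  byFirstPart : ∀ {j} → j < suc n → count P? (block j) ≡ count (P? ∘ (suc j ∷_)) (boundedPartitions (suc j) (n ∸ j))
  byFirstPart {j} j<1+n with suc j ≤? suc n
  ... | no  j≮1+n = ⊥-elim (j≮1+n j<1+n)
  ... | yes _     = trans (count-map P? (suc j ∷_) (partsB n (suc j) (n ∸ j)))
                          (cong (count (P? ∘ (suc j ∷_))) (partsB-fuel (suc j) (n ∸ j) (m∸n≤m n j) ≤-refl))

count-partsB-lowerBound : {P : Pred (List ℕ) ℓ} (P? : Decidable P) {t k : ℕ} →
  (∀ x r → P (x ∷ r) → x ≤ t) → t ≤ k → ∀ f s → count P? (partsB f k s) ≡ count P? (partsB f t s)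
count-partsB-lowerBound P? head≤t t≤k f       zero    = refl
count-partsB-lowerBound P? head≤t t≤k zero    (suc s) = refl
count-partsB-lowerBound P? {t} {k} head≤t t≤k (suc f) (suc s) =
  trans (count-concatMap-applyUpTo P? (block k) id (suc s))
        (trans (∑<-cong (suc s) (λ {j} _ → byFirstPart j))
               (sym (count-concatMap-applyUpTo P? (block t) id (suc s))))
  where
  block : ℕ → ℕ → List (List ℕ)
  block b j = if ⌊ suc j ≤? b ⌋ then map (suc j ∷_) (partsB f (suc j) (s ∸ j)) else []
  byFirstPart : ∀ j → count P? (block k j) ≡ count P? (block t j)
  byFirstPart j with suc j ≤? k | suc j ≤? t
  ... | yes _   | yes _   = refl
  ... | no  _   | no  _   = refl
  ... | no  j≮k | yes j<t = ⊥-elim (j≮k (≤-trans j<t t≤k))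
  ... | yes _   | no  j≮t = trans (count-map P? (suc j ∷_) tails)
                                  (count-none (P? ∘ (suc j ∷_)) tails (All.universal (λ r → j≮t ∘ head≤t (suc j) r) tails))
    where tails = partsB f (suc j) (s ∸ j)

weightedSum : ℕ → List ℕ → ℕ
weightedSum i []       = 0
weightedSum i (x ∷ xs) = i * x + weightedSum (suc i) xs

-- deficitFrom i r = Σₖ (2 (i + k) + 1) rₖ, so that c(p ∷ r) = p − deficit r.
deficitFrom : ℕ → List ℕ → ℕ
deficitFrom i xs = sum xs + 2 * weightedSum i xs

deficit : List ℕ → ℕ
deficit = deficitFrom 0

deficitFrom-∷ : ∀ i x xs → deficitFrom i (x ∷ xs) ≡ (1 + 2 * i) * x + deficitFrom (suc i) xs
deficitFrom-∷ i x xs = solve 4 (λ i x s w → (x :+ s) :+ con 2 :* (i :* x :+ w)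
                                         := (con 1 :+ con 2 :* i) :* x :+ (s :+ con 2 :* w))
                               refl i x (sum xs) (weightedSum (suc i) xs)
  where open +-*-Solver

cycIdxFrom-deficitFrom : ∀ i xs → cycIdxFrom (2 + i) xs ≡ ℤ.- + deficitFrom i xs
cycIdxFrom-deficitFrom i []       = refl
cycIdxFrom-deficitFrom i (x ∷ xs) = begin
  (+ 3 ℤ.- + (2 * (2 + i))) ℤ.* + x ℤ.+ cycIdxFrom (3 + i) xs
    ≡⟨ cong₂ (λ c d → c ℤ.* + x ℤ.+ d) coefficient (cycIdxFrom-deficitFrom (suc i) xs) ⟩
  ℤ.- + k ℤ.* + x ℤ.+ ℤ.- + d
    ≡⟨ cong (ℤ._+ ℤ.- + d) (sym (ℤ.neg-distribˡ-* (+ k) (+ x))) ⟩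
  ℤ.- (+ k ℤ.* + x) ℤ.+ ℤ.- + d
    ≡⟨ sym (ℤ.neg-distrib-+ (+ k ℤ.* + x) (+ d)) ⟩
  ℤ.- (+ k ℤ.* + x ℤ.+ + d)
    ≡⟨ cong ℤ.-_ (sym (trans (ℤ.pos-+ (k * x) d) (cong (ℤ._+ + d) (ℤ.pos-* k x)))) ⟩
  ℤ.- + (k * x + d)
    ≡⟨ cong (ℤ.-_ ∘ +_) (sym (deficitFrom-∷ i x xs)) ⟩
  ℤ.- + deficitFrom i (x ∷ xs) ∎
  where
  open ≡-Reasoning
  k = 1 + 2 * i
  d = deficitFrom (suc i) xs
  coefficient : + 3 ℤ.- + (2 * (2 + i)) ≡ ℤ.- + k
  coefficient = trans (cong (λ n → + 3 ℤ.- + n) (*-distribˡ-+ 2 2 i)) (ℤ.⊖-≤ (m≤m+n 3 k))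

cyclicity-∷ : ∀ p r → cyclicity (p ∷ r) ≡ + p ℤ.- + deficit r
cyclicity-∷ p r = cong₂ ℤ._+_ (ℤ.*-identityˡ (+ p)) (cycIdxFrom-deficitFrom 0 r)

attainable-∷ : ∀ p → (λ r → + 0 ℤ.≤ cyclicity (p ∷ r)) ≐ (λ r → deficit r ≤ p)
attainable-∷ p =
  (λ {r} 0≤c → ℤ.drop‿+≤+ (ℤ.0≤i-j⇒j≤i (subst (+ 0 ℤ.≤_) (cyclicity-∷ p r) 0≤c))) ,
  (λ {r} d≤p → subst (+ 0 ℤ.≤_) (sym (cyclicity-∷ p r)) (ℤ.i≤j⇒0≤j-i (ℤ.+≤+ d≤p)))

balanced-∷ : ∀ p → (λ r → cyclicity (p ∷ r) ≡ + 0) ≐ (λ r → deficit r ≡ p)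
balanced-∷ p =
  (λ {r} c≡0 → sym (ℤ.+-injective (ℤ.i-j≡0⇒i≡j (+ p) (+ deficit r) (trans (sym (cyclicity-∷ p r)) c≡0)))) ,
  (λ {r} d≡p → trans (cyclicity-∷ p r) (ℤ.i≡j⇒i-j≡0 (cong +_ (sym d≡p))))

sum≤deficit : ∀ r → sum r ≤ deficit r
sum≤deficit r = m≤m+n (sum r) _

head≤deficit : ∀ x r → x ≤ deficit (x ∷ r)
head≤deficit x r = ≤-trans (m≤m+n x (sum r)) (m≤m+n (x + sum r) _)

deficit-parity : ∀ r j e → sum r + j ≡ suc (2 * e) → deficit r ≢ j
deficit-parity r j e odd refl = even≢odd (sum r + w) e (trans double odd)
  where
  w = weightedSum 0 r
  double : 2 * (sum r + w) ≡ sum r + (sum r + 2 * w)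
  double = solve 2 (λ s w → con 2 :* (s :+ w) := s :+ (s :+ con 2 :* w)) refl (sum r) w
    where open +-*-Solver

attainableTails balancedTails strictTails : ℕ → ℕ → ℕ
attainableTails p s = count (λ r → deficit r ≤? p) (boundedPartitions p s)
balancedTails   p s = count (λ r → deficit r ≟ p) (boundedPartitions p s)
strictTails     p s = count (λ r → 2 + deficit r ≤? p) (boundedPartitions p s)

zeroCount : ℕ → ℕ
zeroCount n = count (λ l → cyclicity l ℤ.≟ + 0) (partitions n)

a-suc : ∀ n → a (suc n) ≡ ∑< (suc n) (λ j → attainableTails (suc j) (n ∸ j))
a-suc n = trans (count-partitions-suc _ n)
                (∑<-cong (suc n) (λ {j} _ → count-≐ (λ r → + 0 ℤ.≤? cyclicity (suc j ∷ r)) (λ r → deficit r ≤? suc j)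
                                                 (attainable-∷ (suc j)) (boundedPartitions (suc j) (n ∸ j))))

zeroCount-suc : ∀ n → zeroCount (suc n) ≡ ∑< (suc n) (λ j → balancedTails (suc j) (n ∸ j))
zeroCount-suc n = trans (count-partitions-suc _ n)
                        (∑<-cong (suc n) (λ {j} _ → count-≐ (λ r → cyclicity (suc j ∷ r) ℤ.≟ + 0) (λ r → deficit r ≟ suc j)
                                                 (balanced-∷ (suc j)) (boundedPartitions (suc j) (n ∸ j))))

attainableTails-split : ∀ j s e → s + j ≡ suc (2 * e) →
  attainableTails (suc j) s ≡ strictTails (suc j) s + balancedTails (suc j) s
attainableTails-split j s e odd =
  count-⊎ (λ r → deficit r ≤? suc j) (λ r → 2 + deficit r ≤? suc j) (λ r → deficit r ≟ suc j)
          (m+n≤o⇒n≤o 2) ≤-reflexive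
          (λ r 2+d≤p d≡p → 1+n≰n (m+n≤o⇒n≤o 1 (subst (λ d → 2 + d ≤ suc j) d≡p 2+d≤p)))
          (boundedPartitions (suc j) s) (All.map (λ {r} → strictOrBalanced r) (partsB-sum s (suc j) s))
  where
  strictOrBalanced : ∀ r → sum r ≡ s → deficit r ≤ suc j → 2 + deficit r ≤ suc j ⊎ deficit r ≡ suc j
  strictOrBalanced r sum≡s d≤p with m≤n⇒m<n∨m≡n d≤p
  ... | inj₂ d≡p = inj₂ d≡p
  ... | inj₁ d<p = inj₁ (s≤s (≤∧≢⇒< (≤-pred d<p) (deficit-parity r j e (trans (cong (_+ j) sum≡s) odd))))

strictTails-1 : ∀ s → strictTails 1 s ≡ 0
strictTails-1 s = count-none (λ r → 2 + deficit r ≤? 1) (boundedPartitions 1 s) (All.universal (λ { _ (s≤s ()) }) _)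

strictTails-2 : ∀ s → strictTails 2 (suc s) ≡ 0
strictTails-2 s = count-none (λ r → 2 + deficit r ≤? 2) (boundedPartitions 2 (suc s)) (All.map (λ {r} sum≡1+s 2+d≤2 →
                    n≮0 (subst (_≤ 0) sum≡1+s (≤-trans (sum≤deficit r) (≤-pred (≤-pred 2+d≤2)))))
                  (partsB-sum (suc s) 2 (suc s)))

strictTails-lowerBound : ∀ i s → strictTails (3 + i) s ≡ attainableTails (suc i) s
strictTails-lowerBound i s =
  trans (count-≐ (λ r → 2 + deficit r ≤? 3 + i) (λ r → deficit r ≤? suc i)
                 ((λ 2+d≤3+i → ≤-pred (≤-pred 2+d≤3+i)) , (λ d≤1+i → s≤s (s≤s d≤1+i)))
                 (boundedPartitions (3 + i) s))
        (count-partsB-lowerBound (λ r → deficit r ≤? suc i) (λ x r → ≤-trans (head≤deficit x r))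
                                 (m≤n+m (suc i) 2) s s)

a-step : ∀ n e → 2 + n ≡ suc (2 * e) → a (3 + n) ≡ a (1 + n) + zeroCount (3 + n)
a-step n e odd = begin
  a (3 + n)                                 ≡⟨ a-suc (2 + n) ⟩
  ∑< (3 + n) attainable                     ≡⟨ ∑<-cong (3 + n) split ⟩
  ∑< (3 + n) (λ j → strict j + balanced j)  ≡⟨ ∑<-+ (3 + n) strict balanced ⟩
  ∑< (3 + n) strict + ∑< (3 + n) balanced   ≡⟨ cong₂ _+_ strict-∑ (sym (zeroCount-suc (2 + n))) ⟩
  a (1 + n) + zeroCount (3 + n)             ∎
  where
  open ≡-Reasoning
  attainable strict balanced : ℕ → ℕ
  attainable j = attainableTails (suc j) (2 + n ∸ j)
  strict     j = strictTails (suc j) (2 + n ∸ j)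
  balanced   j = balancedTails (suc j) (2 + n ∸ j)
  split : ∀ {j} → j < 3 + n → attainable j ≡ strict j + balanced j
  split {j} j<3+n = attainableTails-split j (2 + n ∸ j) e (trans (m∸n+n≡m (≤-pred j<3+n)) odd)
  strict-∑ : ∑< (3 + n) strict ≡ a (1 + n)
  strict-∑ = begin
    strict 0 + (strict 1 + ∑< (1 + n) (strict ∘ suc ∘ suc))
      ≡⟨ cong₂ (λ x y → x + (y + ∑< (1 + n) (strict ∘ suc ∘ suc))) (strictTails-1 (2 + n)) (strictTails-2 n) ⟩
    ∑< (1 + n) (λ i → strictTails (3 + i) (n ∸ i))
      ≡⟨ ∑<-cong (1 + n) (λ {i} _ → strictTails-lowerBound i (n ∸ i)) ⟩
    ∑< (1 + n) (λ i → attainableTails (suc i) (n ∸ i))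
      ≡⟨ sym (a-suc n) ⟩
    a (1 + n) ∎

lemma5p1 : (m : ℕ) → m ≥ 1 → a (2 * m) ≡ sumTo m z
lemma5p1 (suc zero)    _ = refl
lemma5p1 (suc (suc k)) _ = begin
  a (2 * (2 + k))
    ≡⟨ cong a (*-distribˡ-+ 2 2 k) ⟩
  a (3 + n)
    ≡⟨ a-step n (suc k) (cong suc (sym (*-distribˡ-+ 2 1 k))) ⟩
  a (1 + n) + zeroCount (3 + n)
    ≡⟨ cong₂ _+_ (trans (cong a (sym (*-distribˡ-+ 2 1 k))) (lemma5p1 (suc k) (s≤s z≤n)))
                 (cong zeroCount (sym (*-distribˡ-+ 2 2 k))) ⟩
  sumTo (suc k) z + z (2 + k) ∎
  where
  open ≡-Reasoning
  n = 1 + 2 * k
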